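{- Let $G$ be a connected graph such that $\mathcal{N}_m(G)=\emptyset$ for every positive integer $m$. Then $Dim(G)\ge\left\lfloor\frac{diam(G)-2}{4}\right\rfloor$.
   Context: Graphs are simple and connected; $d$ is the shortest-path distance and $diam(G)$ the diameter. A set $S\subseteq V(G)$ is a $k$-metric generator if for every pair of distinct vertices $u,v$ there are at least $k$ vertices $w\in S$ with $d(u,w)\neq d(v,w)$; $Dim(G)=k$ means $k$ is the largest integer such that a $k$-metric generator exists. For a vertex $v$ and positive integer $m$: $N(v,m)=\{w: d(v,w)\le m\}$, $S(v,m)=\{w: d(v,w)=m\}$, and $\partial N(v,m)=\{w\in S(v,m): d(w,V(G)\setminus N(v,m))=1\}$. Two distinct vertices $v,v'$ have equal $m$-boundary if $\partial N(v,m)=\partial N(v',m)\neq\emptyset$. $\mathcal{N}_m(G)$ is the set of ordered pairs of distinct vertices with equal $m$-boundary. -}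

module Defs where

open import Data.Nat using (ℕ; zero; suc; _≤_; _<_; _≟_)
open import Data.Fin using (Fin)
open import Data.Fin.Subset using (Subset; _∈_)
open import Data.Fin.Subset.Properties using (_∈?_)
open import Data.List using (List; length; filter; allFin)
open import Data.Product using (Σ; ∃; ∃-syntax; _×_; _,_)
open import Relation.Nullary using (¬_)
open import Relation.Nullary.Decidable using (_×-dec_; ¬?)
open import Relation.Binary.PropositionalEquality using (_≡_; _≢_)
open import Function.Bundles using (_⇔_)

record Graph : Set₁ where
  field
    n       : ℕ
    Adj     : Fin n → Fin n → Set
    sym     : ∀ {u v} → Adj u v → Adj v u
    irrefl  : ∀ {u} → ¬ Adj u u

open Graph public

data Walk (G : Graph) : Fin (n G) → Fin (n G) → ℕ → Set where
  stay : ∀ {u} → Walk G u u 0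
  step : ∀ {u w v k} → Adj G u w → Walk G w v k → Walk G u v (suc k)

Connected : Graph → Set
Connected G = ∀ u v → ∃[ k ] Walk G u v k

IsDistance : (G : Graph) → (Fin (n G) → Fin (n G) → ℕ) → Set
IsDistance G d = ∀ u v → Walk G u v (d u v) × (∀ k → Walk G u v k → d u v ≤ k)

module _ (G : Graph) (d : Fin (n G) → Fin (n G) → ℕ) where

  resolvers : Subset (n G) → Fin (n G) → Fin (n G) → ℕ
  resolvers S u v =
    length (filter (λ w → (w ∈? S) ×-dec ¬? (d u w ≟ d v w)) (allFin (n G)))

  IsKMetricGenerator : ℕ → Subset (n G) → Set
  IsKMetricGenerator k S = ∀ u v → u ≢ v → k ≤ resolvers S u v

  IsDim : ℕ → Set
  IsDim k = (∃[ S ] IsKMetricGenerator k S)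
          × (∀ j → ∃[ S ] IsKMetricGenerator j S → j ≤ k)

  IsDiam : ℕ → Set
  IsDiam D = (∃[ u ] ∃[ v ] d u v ≡ D) × (∀ u v → d u v ≤ D)

  -- w ∈ ∂N(v,m): d(v,w) = m and w has distance 1 to V(G) ∖ N(v,m)
  -- (i.e. some x with d(v,x) > m has d(w,x) = 1; if V ∖ N(v,m) is empty,
  -- the distance is undefined and w is not in the boundary)
  InBoundary : Fin (n G) → ℕ → Fin (n G) → Set
  InBoundary v m w = d v w ≡ m × (∃[ x ] (m < d v x × d w x ≡ 1))

  EqualBoundary : ℕ → Fin (n G) → Fin (n G) → Set
  EqualBoundary m v v' =
    v ≢ v'
    × (∀ w → InBoundary v m w ⇔ InBoundary v' m w)
    × (∃[ w ] InBoundary v m w)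

  NoEqualBoundaryPairs : ℕ → Set
  NoEqualBoundaryPairs m = ∀ v v' → ¬ EqualBoundary m v v'

module Submission where

-- Take S = V(G) and fix u ≠ v; let t = d(u,v) and c the number of vertices
-- resolving u and v. The vertices of a u–v geodesic other than its midpoint
-- resolve the pair, so t ≤ c. If d(u,y) ≠ d(v,y), every vertex on a geodesic
-- from the nearer of u, v to y is still nearer to it, so min(d(u,y), d(v,y)) < c
-- and therefore d(u,y) < t + c. Hence for m ≥ t + c the boundaries ∂N(u,m) and
-- ∂N(v,m) coincide, and ∂N(u,m) ≠ ∅ when u has a vertex at distance m + 1.
-- As 𝒩_m(G) = ∅, the eccentricity of u is at most t + c ≤ 2c, so diam(G) ≤ 4c.

open import Defs hiding (sym)
open import Data.Nat using (ℕ; zero; suc; pred; _+_; _*_; _∸_; _/_; _≤_; _<_; s≤s)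
open import Data.Nat.Properties
open import Data.Nat.DivMod using (/-monoˡ-≤; m*n/n≡m)
open import Data.Nat.Tactic.RingSolver using (solve-∀)
open import Data.Fin using (Fin; toℕ)
open import Data.Fin.Properties using (toℕ<n; toℕ-injective; injective⇒≤)
open import Data.Fin.Subset using (⊤) renaming (_∈_ to _∈ₛ_)
open import Data.Fin.Subset.Properties using (_∈?_; ∈⊤)
open import Data.List using (length; filter; allFin; lookup)
open import Data.List.Properties using (filter-≐)
open import Data.List.Membership.Propositional using (_∈_)
open import Data.List.Membership.Propositional.Properties using (∈-filter⁺; ∈-allFin)
open import Data.List.Relation.Unary.Any using (index)
open import Data.List.Relation.Unary.Any.Properties using (lookup-index)
open import Data.Product using (∃-syntax; _×_; _,_; proj₁; proj₂)
open import Data.Empty using (⊥; ⊥-elim)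
open import Function using (_∘_)
open import Function.Bundles using (mk⇔)
open import Function.Definitions using (Injective)
open import Relation.Nullary using (yes; no; contradiction)
open import Relation.Nullary.Decidable using (_×-dec_; ¬?; decidable-stable)
open import Level using (0ℓ)
open import Relation.Unary using (Pred; Decidable)
open import Relation.Binary.Definitions using (tri<; tri≈; tri>)
open import Relation.Binary.PropositionalEquality
  using (_≡_; _≢_; refl; sym; trans; cong; subst; subst₂; module ≡-Reasoning)

labels-cover⇒≤-count : ∀ {m} {P : Pred (Fin m) 0ℓ} (P? : Decidable P) (label : Fin m → ℕ) N
  → (∀ i → i < N → ∃[ w ] P w × label w ≡ i)
  → N ≤ length (filter P? (allFin m))
labels-cover⇒≤-count {m} P? label N cover = injective⇒≤ {f = position} position-injective
  where
  witness : Fin N → Fin m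
  witness k = proj₁ (cover (toℕ k) (toℕ<n k))

  label-witness : ∀ k → label (witness k) ≡ toℕ k
  label-witness k = proj₂ (proj₂ (cover (toℕ k) (toℕ<n k)))

  member : ∀ k → witness k ∈ filter P? (allFin m)
  member k = ∈-filter⁺ P? (∈-allFin _) (proj₁ (proj₂ (cover (toℕ k) (toℕ<n k))))

  position : Fin N → Fin (length (filter P? (allFin m)))
  position k = index (member k)

  position-injective : Injective _≡_ _≡_ position
  position-injective {k} {l} same = toℕ-injective (begin
    toℕ k              ≡⟨ sym (label-witness k) ⟩
    label (witness k)  ≡⟨ cong label (lookup-index (member k)) ⟩
    label (lookup (filter P? (allFin m)) (position k))
                       ≡⟨ cong (label ∘ lookup (filter P? (allFin m))) same ⟩
    label (lookup (filter P? (allFin m)) (position l))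
                       ≡⟨ cong label (sym (lookup-index (member l))) ⟩
    label (witness l)  ≡⟨ label-witness l ⟩
    toℕ l              ∎)
    where open ≡-Reasoning

+-squeeze : ∀ {x y i j} → x ≤ i → y ≤ j → i + j ≤ x + y → x ≡ i × y ≡ j
+-squeeze x≤i y≤j i+j≤x+y =
  ≤-antisym x≤i (≮⇒≥ λ x<i → <⇒≱ (+-mono-<-≤ x<i y≤j) i+j≤x+y) ,
  ≤-antisym y≤j (≮⇒≥ λ y<j → <⇒≱ (+-mono-≤-< x≤i y<j) i+j≤x+y)

-- Index of a vertex along a u–v geodesic, given its distances a to u and b to v,
-- after the midpoint (which does not resolve u and v) has been removed.
geodesicIndex : ℕ → ℕ → ℕ
geodesicIndex a b with a <? b
... | yes _ = a
... | no _  = pred a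

geodesicIndex-< : ∀ {a b} → a < b → geodesicIndex a b ≡ a
geodesicIndex-< {a} {b} a<b with a <? b
... | yes _  = refl
... | no a≮b = contradiction a<b a≮b

geodesicIndex-> : ∀ {a b} → b < a → geodesicIndex a b ≡ pred a
geodesicIndex-> {a} {b} b<a with a <? b
... | yes a<b = contradiction (<-trans a<b b<a) (<-irrefl refl)
... | no _    = refl

module Walks (G : Graph) where

  _▷_ : ∀ {a b c k} → Walk G a b k → Adj G b c → Walk G a c (suc k)
  stay       ▷ e = step e stay
  step e′ w  ▷ e = step e′ (w ▷ e)

  reverse : ∀ {a b k} → Walk G a b k → Walk G b a k
  reverse stay       = stay
  reverse (step e w) = reverse w ▷ Graph.sym G e

  _++_ : ∀ {a b c k l} → Walk G a b k → Walk G b c l → Walk G a c (k + l)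
  stay     ++ w′ = w′
  step e w ++ w′ = step e (w ++ w′)

  splitAt : ∀ {a b} i {j} → Walk G a b (i + j) → ∃[ y ] Walk G a y i × Walk G y b j
  splitAt zero    w          = _ , stay , w
  splitAt (suc i) (step e w) with splitAt i w
  ... | y , p , q = y , step e p , q

  stay-≡ : ∀ {a b} → Walk G a b 0 → a ≡ b
  stay-≡ stay = refl

module Distance (G : Graph) (d : Fin (n G) → Fin (n G) → ℕ) (isD : IsDistance G d) where

  open Walks G

  private V = Fin (n G)

  geodesic : ∀ a b → Walk G a b (d a b)
  geodesic a b = proj₁ (isD a b)

  d-minimal : ∀ {a b k} → Walk G a b k → d a b ≤ k
  d-minimal {a} {b} {k} = proj₂ (isD a b) k

  d-triangle : ∀ a b c → d a c ≤ d a b + d b c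
  d-triangle a b c = d-minimal (geodesic a b ++ geodesic b c)

  d-sym : ∀ a b → d a b ≡ d b a
  d-sym a b = ≤-antisym (d-minimal (reverse (geodesic b a))) (d-minimal (reverse (geodesic a b)))

  d≡0⇒≡ : ∀ {a b} → d a b ≡ 0 → a ≡ b
  d≡0⇒≡ {a} {b} d≡0 = stay-≡ (subst (Walk G a b) d≡0 (geodesic a b))

  geodesic-point : ∀ a b {i} → i ≤ d a b → ∃[ y ] d a y ≡ i × d y b ≡ d a b ∸ i
  geodesic-point a b {i} i≤d
    with splitAt i (subst (Walk G a b) (sym (m+[n∸m]≡n i≤d)) (geodesic a b))
  ... | y , p , q = y , +-squeeze (d-minimal p) (d-minimal q)
                          (subst (_≤ d a y + d y b) (sym (m+[n∸m]≡n i≤d)) (d-triangle a y b))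

  nearer-along-geodesic : ∀ p o r → d p r < d o r
    → ∀ {i} → i ≤ d p r → ∃[ q ] d p q ≡ i × i < d o q
  nearer-along-geodesic p o r p<o {i} i≤d with geodesic-point p r i≤d
  ... | q , pq≡i , qr≡ = q , pq≡i , +-cancelʳ-< (d p r ∸ i) i (d o q) (begin-strict
      i + (d p r ∸ i)    ≡⟨ m+[n∸m]≡n i≤d ⟩
      d p r              <⟨ p<o ⟩
      d o r              ≤⟨ d-triangle o q r ⟩
      d o q + d q r      ≡⟨ cong (d o q +_) qr≡ ⟩
      d o q + (d p r ∸ i) ∎)
    where open ≤-Reasoning

  Resolves : V → V → Pred V 0ℓ
  Resolves u v w = w ∈ₛ ⊤ × d u w ≢ d v w

  resolves? : ∀ u v → Decidable (Resolves u v)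
  resolves? u v w = (w ∈? ⊤) ×-dec ¬? (d u w ≟ d v w)

  resolving : V → V → ℕ
  resolving = resolvers G d ⊤

  resolving-sym : ∀ u v → resolving u v ≡ resolving v u
  resolving-sym u v = cong length (filter-≐ (resolves? u v) (resolves? v u) (flip , flip) (allFin (n G)))
    where
    flip : ∀ {a b w} → Resolves a b w → Resolves b a w
    flip (w∈ , ≢) = w∈ , ≢ ∘ sym

  nearer⇒<resolving : ∀ u v r → d u r < d v r → d u r < resolving u v
  nearer⇒<resolving u v r u<v = labels-cover⇒≤-count (resolves? u v) (d u) (suc (d u r)) cover
    where
    cover : ∀ i → i < suc (d u r) → ∃[ w ] Resolves u v w × d u w ≡ i
    cover i (s≤s i≤d) with nearer-along-geodesic u v r u<v i≤d
    ... | q , uq≡i , i<vq = q , (∈⊤ , λ uq≡vq → <⇒≢ i<vq (trans (sym uq≡i) uq≡vq)) , uq≡i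

  d≤resolving : ∀ u v → d u v ≤ resolving u v
  d≤resolving u v =
    labels-cover⇒≤-count (resolves? u v) (λ w → geodesicIndex (d u w) (d v w)) (d u v) cover
    where
    cover : ∀ i → i < d u v → ∃[ w ] Resolves u v w × geodesicIndex (d u w) (d v w) ≡ i
    cover i i<d with i + i <? d u v
    ... | yes 2i<d with geodesic-point u v (<⇒≤ i<d)
    ...   | q , uq≡i , qv≡ = q , (∈⊤ , <⇒≢ near) , trans (geodesicIndex-< near) uq≡i
      where
      near : d u q < d v q
      near = subst₂ _<_ (sym uq≡i) (sym (trans (d-sym v q) qv≡)) (m+n≤o⇒m≤o∸n (suc i) 2i<d)
    cover i i<d | no 2i≮d with geodesic-point u v i<d
    ...   | q , uq≡ , qv≡ = q , (∈⊤ , <⇒≢ near ∘ sym) , trans (geodesicIndex-> near) (cong pred uq≡)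
      where
      near : d v q < d u q
      near = subst₂ _<_ (sym (trans (d-sym v q) qv≡)) (sym uq≡)
               (m<n+o⇒m∸n<o (d u v) (suc i) (≤-<-trans (≮⇒≥ 2i≮d) (s≤s (+-monoʳ-≤ i (n≤1+n i)))))

  resolved⇒d< : ∀ u v y → d u y ≢ d v y → d u y < d u v + resolving u v
  resolved⇒d< u v y uy≢vy with <-cmp (d u y) (d v y)
  ... | tri< u<v _ _ = <-≤-trans (nearer⇒<resolving u v y u<v) (m≤n+m (resolving u v) (d u v))
  ... | tri≈ _ uy≡vy _ = contradiction uy≡vy uy≢vy
  ... | tri> _ _ v<u = begin-strict
    d u y                  ≤⟨ d-triangle u v y ⟩
    d u v + d v y          <⟨ +-monoʳ-< (d u v) (nearer⇒<resolving v u y v<u) ⟩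
    d u v + resolving v u  ≡⟨ cong (d u v +_) (resolving-sym v u) ⟩
    d u v + resolving u v  ∎
    where open ≤-Reasoning

  boundary-transfer : ∀ u v {m w} → d u v + resolving u v ≤ m
    → InBoundary G d u m w → InBoundary G d v m w
  boundary-transfer u v {m} t+c≤m (uw≡m , x , m<ux , wx≡1) = vw≡m , x , m<vx , wx≡1
    where
    unresolved : ∀ {y} → m ≤ d u y → d u y ≡ d v y
    unresolved {y} m≤uy = decidable-stable (d u y ≟ d v y)
      λ uy≢vy → <⇒≱ (resolved⇒d< u v y uy≢vy) (≤-trans t+c≤m m≤uy)

    vw≡m = trans (sym (unresolved (≤-reflexive (sym uw≡m)))) uw≡m
    m<vx = subst (m <_) (unresolved (<⇒≤ m<ux)) m<ux

  boundary-nonempty : ∀ u x {m} → d u x ≡ suc m → ∃[ w ] InBoundary G d u m w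
  boundary-nonempty u x {m} ux≡1+m with geodesic-point u x (subst (m ≤_) (sym ux≡1+m) (n≤1+n m))
  ... | w , uw≡m , wx≡ = w , uw≡m , x , subst (m <_) (sym ux≡1+m) (n<1+n m) ,
                         trans wx≡ (trans (cong (_∸ m) ux≡1+m) (m+n∸n≡m 1 m))

  equalBoundary : ∀ {u v m} → u ≢ v → d u v + resolving u v ≤ m
    → ∃[ w ] InBoundary G d u m w → EqualBoundary G d m u v
  equalBoundary {u} {v} {m} u≢v t+c≤m nonempty =
    u≢v , (λ _ → mk⇔ (boundary-transfer u v t+c≤m) (boundary-transfer v u t+c≤m′)) , nonempty
    where
    t+c≤m′ : d v u + resolving v u ≤ m
    t+c≤m′ = subst₂ (λ t c → t + c ≤ m) (d-sym u v) (resolving-sym u v) t+c≤m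

  module _ (noEqual : ∀ m → NoEqualBoundaryPairs G d (suc m)) where

    eccentricity-bound : ∀ {u v} → u ≢ v → ∀ x → d u x ≤ d u v + resolving u v
    eccentricity-bound {u} {v} u≢v x with d u x ≤? d u v + resolving u v
    ... | yes ux≤t+c = ux≤t+c
    ... | no ux≰t+c = ⊥-elim (too-far (d u x) refl (≰⇒> ux≰t+c))
      where
      too-far : ∀ e → d u x ≡ e → d u v + resolving u v < e → ⊥
      too-far (suc zero) _ (s≤s t+c≤0) =
        <⇒≱ (n≢0⇒n>0 (u≢v ∘ d≡0⇒≡)) (≤-trans (m≤m+n (d u v) (resolving u v)) t+c≤0)
      too-far (suc (suc m)) ux≡2+m (s≤s t+c≤1+m) =
        noEqual m u v (equalBoundary u≢v t+c≤1+m (boundary-nonempty u x ux≡2+m))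

    diameter-bound : ∀ {u v} → u ≢ v → ∀ u₀ v₀ → d u₀ v₀ ≤ resolving u v * 4
    diameter-bound {u} {v} u≢v u₀ v₀ = begin
      d u₀ v₀            ≤⟨ d-triangle u₀ u v₀ ⟩
      d u₀ u + d u v₀    ≡⟨ cong (_+ d u v₀) (d-sym u₀ u) ⟩
      d u u₀ + d u v₀    ≤⟨ +-mono-≤ (eccentricity≤2c u₀) (eccentricity≤2c v₀) ⟩
      (c + c) + (c + c)  ≡⟨ 4×≡*4 c ⟩
      c * 4              ∎
      where
      open ≤-Reasoning
      c = resolving u v
      eccentricity≤2c : ∀ x → d u x ≤ c + c
      eccentricity≤2c x = ≤-trans (eccentricity-bound u≢v x) (+-monoˡ-≤ c (d≤resolving u v))
      4×≡*4 : ∀ c → (c + c) + (c + c) ≡ c * 4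
      4×≡*4 = solve-∀

[D∸2]/4≤ : ∀ {D c} → D ≤ c * 4 → (D ∸ 2) / 4 ≤ c
[D∸2]/4≤ {D} {c} D≤4c = ≤-trans (/-monoˡ-≤ 4 (≤-trans (m∸n≤m D 2) D≤4c)) (≤-reflexive (m*n/n≡m c 4))

theorem2p6 : (G : Graph) → Connected G
    → (d : Fin (n G) → Fin (n G) → ℕ) → IsDistance G d
    → (∀ m → NoEqualBoundaryPairs G d (suc m))
    → ∀ D k → IsDiam G d D → IsDim G d k
    → (D ∸ 2) / 4 ≤ k
theorem2p6 G _ d isD noEqual D k ((u₀ , v₀ , u₀v₀≡D) , _) (_ , maximal) =
  maximal ((D ∸ 2) / 4) (⊤ , λ u v u≢v →
    [D∸2]/4≤ (subst (_≤ _) u₀v₀≡D (Distance.diameter-bound G d isD noEqual u≢v u₀ v₀)))
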